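{- Let $\pi$ be a permutation of $[n]$ and let $P_\pi$ be the poset on $[n]$ with $a\leq b$ iff $a\leq b$ as integers and $\pi^{ -1}(a)\leq\pi^{ -1}(b)$. Suppose that either $P_\pi$ is an antichain, or $P_\pi$ is pure and for every $0\le i\le\operatorname{rank}(P_\pi)-1$ the induced subposet of $P_\pi$ consisting of the elements of height $i$ and height $i+1$ is connected. Let $x\le y$ in $P_\pi$ with $\operatorname{height}(x)=i$, $\operatorname{height}(y)=j$ and $j-i\geq 2$. Let $x=y_i\lessdot y_{i+1}\lessdot\cdots\lessdot y_j=y$ be a chain in the interval $[x,y]$ such that for every $k$ with $i<k<j$ there is an element $x_k\in[x,y]$ with $x_k\lessdot_k y_k$. Then there exists an integer $k'$ with $i<k'<j$ such that $y_{k'-1}\lessdot x_{k'}\lessdot y_{k'+1}$.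
   Context: A chain's length is its cardinality minus one; $\operatorname{rank}(P)$ is the maximum chain length; $P$ is pure if all maximal chains have equal length. The height of $p$ is the rank of $\{q: q\le p\}$. An antichain has no two distinct comparable elements. A poset is connected if it is not the disjoint union (with no relations between the parts) of two nonempty induced subposets. $a\lessdot b$ means $b$ covers $a$ in $P_\pi$: $a<b$ and there is no $z$ with $a<z<b$. The interval $[x,y]=\{z\in P_\pi : x\le z\le y\}$. For each $k$, let $P_k$ be the set of elements of $P_\pi$ of height $k$, with the linear order $<_k$ defined by $a<_k b$ iff $a>b$ as integers; $a\lessdot_k b$ means $a<_k b$ and there is no $c\in P_k$ with $a<_k c<_k b$. -}

module Defs where

open import Data.Nat using (ℕ; zero; suc; _+_; _≤_; _<_)
open import Data.Fin using (Fin; toℕ)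
open import Data.Fin.Permutation using (Permutation′; _⟨$⟩ˡ_)
open import Data.Bool using (Bool; true; false)
open import Data.List using (List; length)
open import Data.List.Membership.Propositional using (_∈_)
open import Data.List.Relation.Unary.All using (All)
open import Data.List.Relation.Unary.Linked using (Linked)
open import Data.Product using (Σ; ∃; _×_)
open import Data.Sum using (_⊎_)
open import Relation.Binary.PropositionalEquality using (_≡_; _≢_)
open import Relation.Nullary using (¬_)

-- [n] is modelled by Fin n = {0,…,n-1} (an order-preserving shift of {1,…,n}).
module _ {n : ℕ} (π : Permutation′ n) where

  _≤P_ : Fin n → Fin n → Set
  a ≤P b = toℕ a ≤ toℕ b × toℕ (π ⟨$⟩ˡ a) ≤ toℕ (π ⟨$⟩ˡ b)

  _<P_ : Fin n → Fin n → Set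
  a <P b = a ≤P b × a ≢ b

  _⋖_ : Fin n → Fin n → Set
  a ⋖ b = a <P b × (∀ z → ¬ (a <P z × z <P b))

  -- a chain, listed in strictly increasing order; its length is (list length) − 1
  Chain : List (Fin n) → Set
  Chain c = Linked _<P_ c

  Rank : ℕ → Set
  Rank r = (∃ λ c → Chain c × length c ≡ suc r)
         × (∀ c → Chain c → length c ≤ suc r)

  Height : Fin n → ℕ → Set
  Height p h = (∃ λ c → Chain c × All (_≤P p) c × length c ≡ suc h)
             × (∀ c → Chain c → All (_≤P p) c → length c ≤ suc h)

  MaximalChain : List (Fin n) → Set
  MaximalChain c = Chain c × (∀ d → Chain d → (∀ a → a ∈ c → a ∈ d) → ∀ a → a ∈ d → a ∈ c)

  Pure : Set
  Pure = ∀ c d → MaximalChain c → MaximalChain d → length c ≡ length d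

  IsAntichain : Set
  IsAntichain = ∀ a b → a ≤P b → a ≡ b

  -- the induced subposet on S is connected: it is not the disjoint union of two
  -- nonempty induced subposets (sides given by a Bool labelling) with no relations between them
  Connected : (Fin n → Set) → Set
  Connected S = ¬ (Σ (Fin n → Bool) λ side →
                      (∃ λ a → S a × side a ≡ true)
                    × (∃ λ b → S b × side b ≡ false)
                    × (∀ a b → S a → S b → a ≤P b → side a ≡ side b))

  Levels : ℕ → Fin n → Set
  Levels i a = Height a i ⊎ Height a (suc i)

  -- a ⋖_k b in P_k, where a <_k b iff a > b as integers
  _⋖[_]_ : Fin n → ℕ → Fin n → Set
  a ⋖[ k ] b = Height a k × Height b k × toℕ b < toℕ a
             × (∀ c → Height c k → ¬ (toℕ c < toℕ a × toℕ b < toℕ c))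

-- Write G k for y_k ≤ x_{k+1} and D k for x_{k+1} ≤ y_{k+2}. G i holds as y_i = x,
-- D (j-2) holds as y_j = y, and ¬ D k implies G (k+1); hence some k has both G k
-- and D k, and since y_k, x_{k+1}, y_{k+2} have heights k, k+1, k+2 these are covers.
-- Connectedness gives ¬ D k → G (k+1): each level of P_π is an antichain, hence
-- decreasing in π⁻¹, and otherwise cutting levels k+1, k+2 at the value y_{k+2}
-- would split them into two nonempty parts with no relations between them.
module Submission where

open import Defs
open import Data.Nat using (ℕ; zero; suc; _+_; _∸_; _≤_; _<_; z≤n; s≤s; _≤?_)
open import Data.Nat.Properties hiding (_≟_)
open import Data.Fin using (Fin; toℕ; _≟_)
open import Data.Fin.Properties using (toℕ-injective; toℕ<n; any?)
open import Data.Fin.Permutation using (Permutation′; _⟨$⟩ˡ_)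
open import Data.Product using (∃; _×_; _,_; proj₁; proj₂)
open import Data.Sum using (_⊎_; inj₁; inj₂)
open import Data.List using (List; []; _∷_; _∷ʳ_; length)
open import Data.List.Properties using (length-++)
open import Data.List.Relation.Unary.All as All using (All; []; _∷_)
open import Data.List.Relation.Unary.All.Properties using (∷ʳ⁺)
open import Data.List.Relation.Unary.Linked as Linked using (Linked; []; [-]; _∷_)
open import Data.Empty using (⊥; ⊥-elim)
open import Function using (_on_; _⇔_; mk⇔)
open import Level using (0ℓ)
open import Relation.Binary using (Rel)
open import Relation.Nullary using (¬_; Dec; yes; no; does; contradiction)
open import Relation.Nullary.Decidable using (_×-dec_; ¬?; map′; does-⇔; dec-true; dec-false)
open import Relation.Binary.PropositionalEquality using (_≡_; _≢_; refl; trans; cong; subst)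

Linked-∷ʳ⁺ : ∀ {a r} {A : Set a} {R : Rel A r} {x : A} {xs : List A} →
             Linked R xs → All (λ z → R z x) xs → Linked R (xs ∷ʳ x)
Linked-∷ʳ⁺ []            []             = [-]
Linked-∷ʳ⁺ [-]           (Rzx ∷ [])     = Rzx ∷ [-]
Linked-∷ʳ⁺ (Rzw ∷ Rwxs)  (_ ∷ Rws)      = Rzw ∷ Linked-∷ʳ⁺ Rwxs Rws

Linked-<-length+toℕ : ∀ {n} {p : Fin n} {c : List (Fin n)} →
                      Linked (_<_ on toℕ) (p ∷ c) → length (p ∷ c) + toℕ p ≤ n
Linked-<-length+toℕ {p = p} [-] = toℕ<n p
Linked-<-length+toℕ {p = p} {q ∷ c} (p<q ∷ q∷c) = begin
  suc (suc (length c) + toℕ p)  ≡⟨ +-suc (suc (length c)) (toℕ p) ⟨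
  suc (length c) + suc (toℕ p)  ≤⟨ +-monoʳ-≤ (suc (length c)) p<q ⟩
  suc (length c) + toℕ q        ≤⟨ Linked-<-length+toℕ q∷c ⟩
  _                             ∎
  where open ≤-Reasoning

Linked-<-length : ∀ {n} {c : List (Fin n)} → Linked (_<_ on toℕ) c → length c ≤ n
Linked-<-length []                  = z≤n
Linked-<-length {c = c@(_ ∷ _)} chain = m+n≤o⇒m≤o (length c) (Linked-<-length+toℕ chain)

module _ {n : ℕ} {R : Rel (Fin n) 0ℓ} (R? : ∀ a b → Dec (R a b)) where

  linked-from? : ∀ m p → Dec (∃ λ c → Linked R (p ∷ c) × length c ≡ m)
  linked-from? zero    p = yes ([] , [-] , refl)
  linked-from? (suc m) p = map′
    (λ { (q , Rpq , c , chain , len) → q ∷ c , Rpq ∷ chain , cong suc len })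
    (λ { ([] , _ , ()) ; (q ∷ c , Rpq ∷ chain , len) → q , Rpq , c , chain , suc-injective len })
    (any? (λ q → R? p q ×-dec linked-from? m q))

  linked? : ∀ m → Dec (∃ λ c → Linked R c × length c ≡ suc m)
  linked? m = map′
    (λ { (p , c , chain , len) → p ∷ c , chain , cong suc len })
    (λ { ([] , _ , ()) ; (p ∷ c , chain , len) → p , c , chain , suc-injective len })
    (any? (linked-from? m))

greatest : {Q : ℕ → Set} → (∀ m → Dec (Q m)) → ∀ t → (∀ {m} → Q m → m ≤ t) →
           ∀ {m} → Q m → ∃ λ r → Q r × (∀ {m} → Q m → m ≤ r)
greatest Q? t bound q with Q? t
... | yes qt = t , qt , bound
greatest Q? zero bound q | no ¬qt with bound q
... | z≤n = contradiction q ¬qt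
greatest {Q} Q? (suc t) bound q | no ¬qt = greatest Q? t bound′ q
  where
  bound′ : ∀ {m} → Q m → m ≤ t
  bound′ qm = ≤-pred (≤∧≢⇒< (bound qm) λ { refl → ¬qt qm })

crossing : {G D : ℕ → Set} → (∀ k → Dec (D k)) → ∀ {a} b → a ≤ b → G a → D b →
           (∀ k → a ≤ k → k < b → ¬ D k → G (suc k)) →
           ∃ λ k → a ≤ k × k ≤ b × G k × D k
crossing D? zero z≤n Ga Db step = zero , z≤n , z≤n , Ga , Db
crossing D? (suc b) a≤1+b Ga Db step with m≤n⇒m<n∨m≡n a≤1+b
... | inj₂ refl = suc b , ≤-refl , ≤-refl , Ga , Db
... | inj₁ (s≤s a≤b) with D? b
...   | no ¬Db = suc b , a≤1+b , ≤-refl , step b a≤b ≤-refl ¬Db , Db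
...   | yes Db′ with crossing D? b a≤b Ga Db′ (λ k a≤k k<b → step k a≤k (m≤n⇒m≤1+n k<b))
...     | k , a≤k , k≤b , Gk , Dk = k , a≤k , m≤n⇒m≤1+n k≤b , Gk , Dk

module _ {n : ℕ} (π : Permutation′ n) where

  pos : Fin n → ℕ
  pos a = toℕ (π ⟨$⟩ˡ a)

  infix 4 _≼_ _≺_ _≼?_ _≺?_

  _≼_ : Fin n → Fin n → Set
  _≼_ = _≤P_ π

  _≺_ : Fin n → Fin n → Set
  _≺_ = _<P_ π

  _≼?_ : ∀ a b → Dec (a ≼ b)
  a ≼? b = (toℕ a ≤? toℕ b) ×-dec (pos a ≤? pos b)

  _≺?_ : ∀ a b → Dec (a ≺ b)
  a ≺? b = (a ≼? b) ×-dec ¬? (a ≟ b)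

  ≼-refl : ∀ {a} → a ≼ a
  ≼-refl = ≤-refl , ≤-refl

  ≼-trans : ∀ {a b c} → a ≼ b → b ≼ c → a ≼ c
  ≼-trans (a≤b , πa≤πb) (b≤c , πb≤πc) = ≤-trans a≤b b≤c , ≤-trans πa≤πb πb≤πc

  ≺⇒toℕ< : ∀ {a b} → a ≺ b → toℕ a < toℕ b
  ≺⇒toℕ< ((a≤b , _) , a≢b) = ≤∧≢⇒< a≤b (λ eq → a≢b (toℕ-injective eq))

  ≼-≺-trans : ∀ {a b c} → a ≼ b → b ≺ c → a ≺ c
  ≼-≺-trans a≼b b≺c@(b≼c , _) =
    ≼-trans a≼b b≼c , λ { refl → <-irrefl refl (≤-<-trans (proj₁ a≼b) (≺⇒toℕ< b≺c)) }

  IsAntichain⇒¬⋖ : IsAntichain π → ∀ {a b} → ¬ (_⋖_ π a b)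
  IsAntichain⇒¬⋖ antichain ((a≼b , a≢b) , _) = a≢b (antichain _ _ a≼b)

  ChainBelow : Fin n → ℕ → Set
  ChainBelow p h = ∃ λ c → Chain π c × All (_≼ p) c × length c ≡ suc h

  ChainBelow-extend : ∀ {a b h} → ChainBelow a h → a ≺ b → ChainBelow b (suc h)
  ChainBelow-extend {b = b} (c , chain , below , len) a≺b =
    c ∷ʳ b ,
    Linked-∷ʳ⁺ chain (All.map (λ z≼a → ≼-≺-trans z≼a a≺b) below) ,
    ∷ʳ⁺ (All.map (λ z≼a → ≼-trans z≼a (proj₁ a≺b)) below) ≼-refl ,
    trans (length-++ c) (trans (+-comm (length c) 1) (cong suc len))

  ChainBelow⇒≤height : ∀ {p m h} → ChainBelow p m → Height π p h → m ≤ h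
  ChainBelow⇒≤height (c , chain , below , len) (_ , longest) =
    ≤-pred (subst (_≤ _) len (longest c chain below))

  ≺⇒height< : ∀ {a b h h′} → a ≺ b → Height π a h → Height π b h′ → h < h′
  ≺⇒height< a≺b Ha Hb = ChainBelow⇒≤height (ChainBelow-extend (proj₁ Ha) a≺b) Hb

  height-unique : ∀ {p h h′} → Height π p h → Height π p h′ → h ≡ h′
  height-unique H H′ =
    ≤-antisym (ChainBelow⇒≤height (proj₁ H) H′) (ChainBelow⇒≤height (proj₁ H′) H)

  ≼⇒height≤ : ∀ {a b h h′} → a ≼ b → Height π a h → Height π b h′ → h ≤ h′
  ≼⇒height≤ {a} {b} a≼b Ha Hb with a ≟ b
  ... | yes refl = ≤-reflexive (height-unique Ha Hb)
  ... | no a≢b   = <⇒≤ (≺⇒height< (a≼b , a≢b) Ha Hb)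

  same-height-≼⇒≡ : ∀ {a b h} → a ≼ b → Height π a h → Height π b h → a ≡ b
  same-height-≼⇒≡ {a} {b} a≼b Ha Hb with a ≟ b
  ... | yes a≡b = a≡b
  ... | no a≢b  = contradiction (≺⇒height< (a≼b , a≢b) Ha Hb) (<-irrefl refl)

  same-height-antitone : ∀ {a b h} → Height π a h → Height π b h → toℕ a ≤ toℕ b → pos b ≤ pos a
  same-height-antitone {a} {b} Ha Hb a≤b with ≤-total (pos b) (pos a)
  ... | inj₁ πb≤πa = πb≤πa
  ... | inj₂ πa≤πb with same-height-≼⇒≡ (a≤b , πa≤πb) Ha Hb
  ...   | refl = ≤-refl

  height-suc-≼⇒⋖ : ∀ {a b h} → Height π a h → Height π b (suc h) → a ≼ b → _⋖_ π a b
  height-suc-≼⇒⋖ {a} {b} {h} Ha Hb a≼b = (a≼b , a≢b) , λ z (a≺z , z≺b) →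
    <-irrefl refl (ChainBelow⇒≤height (ChainBelow-extend (ChainBelow-extend (proj₁ Ha) a≺z) z≺b) Hb)
    where
    a≢b : a ≢ b
    a≢b refl = <-irrefl (height-unique Ha Hb) (n<1+n h)

  ChainOfLength : ℕ → Set
  ChainOfLength m = ∃ λ c → Chain π c × length c ≡ suc m

  ChainOfLength⇒≤ : ∀ {m} → ChainOfLength m → m ≤ n
  ChainOfLength⇒≤ (c , chain , len) =
    <⇒≤ (subst (_≤ n) len (Linked-<-length (Linked.map ≺⇒toℕ< chain)))

  height≤rank : ∀ {p h} → Height π p h → ∃ λ r → Rank π r × h ≤ r
  height≤rank ((c , chain , _ , len) , _)
    with greatest (linked? _≺?_) n ChainOfLength⇒≤ (c , chain , len)
  ... | r , longest , maximal = r , (longest , every-chain) , maximal (c , chain , len)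
    where
    every-chain : ∀ c → Chain π c → length c ≤ suc r
    every-chain []      _     = z≤n
    every-chain (p ∷ c) chain = s≤s (maximal (p ∷ c , chain , refl))

  ⋖[]-below : ∀ {a b c k} → _⋖[_]_ π a k b → Height π c k → toℕ c < toℕ a → toℕ c ≤ toℕ b
  ⋖[]-below (_ , _ , _ , gap) Hc c<a = ≮⇒≥ λ b<c → gap _ Hc (c<a , b<c)

  ⋖[]-above : ∀ {a b c k} → _⋖[_]_ π a k b → Height π c k → toℕ b < toℕ c → toℕ a ≤ toℕ c
  ⋖[]-above (_ , _ , _ , gap) Hc b<c = ≮⇒≥ λ c<a → gap _ Hc (c<a , b<c)

  Connected⇒¬cut : ∀ {S : Fin n → Set} → Connected π S → {L : Fin n → Set} → (∀ a → Dec (L a)) →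
                   (∃ λ a → S a × L a) → (∃ λ b → S b × ¬ L b) →
                   (∀ {a b} → S a → S b → a ≼ b → L a ⇔ L b) → ⊥
  Connected⇒¬cut connected L? (a , Sa , La) (b , Sb , ¬Lb) closed = connected
    ( (λ w → does (L? w))
    , (a , Sa , dec-true (L? a) La)
    , (b , Sb , dec-false (L? b) ¬Lb)
    , λ a b Sa Sb a≼b → does-⇔ (closed Sa Sb a≼b) (L? a) (L? b) )

  -- Cut levels k, k+1 by the value of y′: the cut is closed downwards trivially, and
  -- closed upwards because a ≤ b across the cut would give π⁻¹ y ≤ π⁻¹ a ≤ π⁻¹ b ≤ π⁻¹ x′.
  exchange : ∀ {k x y x′ y′} → Connected π (Levels π k) → y ≼ y′ →
             _⋖[_]_ π x k y → _⋖[_]_ π x′ (suc k) y′ → ¬ x ≼ y′ → y ≼ x′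
  exchange {k} {x} {y} {x′} {y′} connected y≼y′
           x⋖y@(Hx , Hy , y<x , _) x′⋖y′@(Hx′ , _ , y′<x′ , _) x⋠y′
    with pos y ≤? pos x′
  ... | yes πy≤πx′ = ≤-trans (proj₁ y≼y′) (<⇒≤ y′<x′) , πy≤πx′
  ... | no πy≰πx′  = ⊥-elim (Connected⇒¬cut connected (λ w → toℕ w ≤? toℕ y′)
                       (y , inj₁ Hy , proj₁ y≼y′) (x , inj₁ Hx , <⇒≱ y′<x) closed)
    where
    y′<x : toℕ y′ < toℕ x
    y′<x = ≰⇒> λ x≤y′ →
      x⋠y′ (x≤y′ , ≤-trans (same-height-antitone Hy Hx (<⇒≤ y<x)) (proj₂ y≼y′))

    upward : ∀ {a b} → Levels π k a → Levels π k b → a ≼ b → toℕ a ≤ toℕ y′ → toℕ b ≤ toℕ y′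
    upward (inj₁ Ha) (inj₁ Hb) a≼b with same-height-≼⇒≡ a≼b Ha Hb
    ... | refl = λ a≤y′ → a≤y′
    upward (inj₂ Ha) (inj₂ Hb) a≼b with same-height-≼⇒≡ a≼b Ha Hb
    ... | refl = λ a≤y′ → a≤y′
    upward (inj₂ Ha) (inj₁ Hb) a≼b _ = contradiction (≼⇒height≤ a≼b Ha Hb) (<⇒≱ (n<1+n k))
    upward (inj₁ Ha) (inj₂ Hb) (_ , πa≤πb) a≤y′ = ≮⇒≥ λ y′<b → πy≰πx′ (begin
      pos y  ≤⟨ same-height-antitone Ha Hy (⋖[]-below x⋖y Ha (≤-<-trans a≤y′ y′<x)) ⟩
      pos _  ≤⟨ πa≤πb ⟩
      pos _  ≤⟨ same-height-antitone Hx′ Hb (⋖[]-above x′⋖y′ Hb y′<b) ⟩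
      pos x′ ∎)
      where open ≤-Reasoning

    closed : ∀ {a b} → Levels π k a → Levels π k b → a ≼ b →
             (toℕ a ≤ toℕ y′) ⇔ (toℕ b ≤ toℕ y′)
    closed La Lb a≼b = mk⇔ (upward La Lb a≼b) (≤-trans (proj₁ a≼b))

  levels-connected⇒cover-through-xs : ∀ {x y i j} →
    (∀ k → k < j → Connected π (Levels π k)) →
    Height π x i → Height π y j → 2 + i ≤ j →
    (ys : ℕ → Fin n) → ys i ≡ x → ys j ≡ y →
    (∀ k → i ≤ k → k < j → _⋖_ π (ys k) (ys (suc k))) →
    (xs : ℕ → Fin n) →
    (∀ k → i < k → k < j → x ≼ xs k × xs k ≼ y × _⋖[_]_ π (xs k) k (ys k)) →
    ∃ λ k → i < k × k < j × _⋖_ π (ys (k ∸ 1)) (xs k) × _⋖_ π (xs k) (ys (suc k))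
  levels-connected⇒cover-through-xs {i = i} {j = .(2 + b)} connected Hx Hy (s≤s (s≤s {n = b} i≤b))
                                     ys refl refl ys⋖ys xs between
    = let m , i≤m , m≤b , ys≼xs , xs≼ys = crossing {G = λ m → ys m ≼ xs (suc m)}
            (λ m → xs (suc m) ≼? ys (2 + m)) b i≤b ys≼xs-bottom xs≼ys-top step
          Hxs = height-xs (suc m) (s≤s i≤m) (s≤s (s≤s m≤b))
      in suc m , s≤s i≤m , s≤s (s≤s m≤b) ,
         height-suc-≼⇒⋖ (height-ys m i≤m (m≤n⇒m≤o+n 2 m≤b)) Hxs ys≼xs ,
         height-suc-≼⇒⋖ Hxs (height-ys (2 + m) (m≤n⇒m≤o+n 2 i≤m) (s≤s (s≤s m≤b))) xs≼ys
    where
    xs⋖ys : ∀ k → i < k → k < 2 + b → _⋖[_]_ π (xs k) k (ys k)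
    xs⋖ys k i<k k<j = proj₂ (proj₂ (between k i<k k<j))

    height-xs : ∀ k → i < k → k < 2 + b → Height π (xs k) k
    height-xs k i<k k<j = proj₁ (xs⋖ys k i<k k<j)

    height-ys : ∀ k → i ≤ k → k ≤ 2 + b → Height π (ys k) k
    height-ys k i≤k k≤j with m≤n⇒m<n∨m≡n i≤k | m≤n⇒m<n∨m≡n k≤j
    ... | inj₂ refl | _         = Hx
    ... | inj₁ _    | inj₂ refl = Hy
    ... | inj₁ i<k  | inj₁ k<j  = proj₁ (proj₂ (xs⋖ys k i<k k<j))

    ys≼xs-bottom : ys i ≼ xs (suc i)
    ys≼xs-bottom = proj₁ (between (suc i) ≤-refl (s≤s (s≤s i≤b)))

    xs≼ys-top : xs (suc b) ≼ ys (2 + b)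
    xs≼ys-top = proj₁ (proj₂ (between (suc b) (s≤s i≤b) ≤-refl))

    step : ∀ m → i ≤ m → m < b → ¬ xs (suc m) ≼ ys (2 + m) → ys (suc m) ≼ xs (2 + m)
    step m i≤m m<b = exchange (connected (suc m) 1+m<j)
      (proj₁ (proj₁ (ys⋖ys (suc m) (m≤n⇒m≤1+n i≤m) 1+m<j)))
      (xs⋖ys (suc m) (s≤s i≤m) 1+m<j)
      (xs⋖ys (2 + m) (s≤s (m≤n⇒m≤1+n i≤m)) (s≤s (s≤s m<b)))
      where
      1+m<j : suc m < 2 + b
      1+m<j = s≤s (m≤n⇒m≤1+n m<b)

lemma3p3 : (n : ℕ) (π : Permutation′ n) →
    (IsAntichain π ⊎ (Pure π × (∀ r → Rank π r → ∀ i → i < r → Connected π (Levels π i)))) →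
    (x y : Fin n) (i j : ℕ) →
    _≤P_ π x y → Height π x i → Height π y j → 2 + i ≤ j →
    (ys : ℕ → Fin n) → ys i ≡ x → ys j ≡ y →
    (∀ k → i ≤ k → k < j → _⋖_ π (ys k) (ys (suc k))) →
    (xs : ℕ → Fin n) →
    (∀ k → i < k → k < j → _≤P_ π x (xs k) × _≤P_ π (xs k) y × _⋖[_]_ π (xs k) k (ys k)) →
    ∃ λ k → i < k × k < j × _⋖_ π (ys (k ∸ 1)) (xs k) × _⋖_ π (xs k) (ys (suc k))
lemma3p3 n π (inj₁ antichain) x y i j _ _ _ 2+i≤j ys _ _ ys⋖ys _ _ =
  contradiction (ys⋖ys i ≤-refl (m+n≤o⇒n≤o 1 2+i≤j)) (IsAntichain⇒¬⋖ π antichain)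
lemma3p3 n π (inj₂ (_ , levels-connected)) x y i j _ Hx Hy 2+i≤j ys ys-x ys-y ys⋖ys xs between
  with height≤rank π Hy
... | r , rank , j≤r =
  levels-connected⇒cover-through-xs π (λ k k<j → levels-connected r rank k (<-≤-trans k<j j≤r))
    Hx Hy 2+i≤j ys ys-x ys-y ys⋖ys xs between
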